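{- Let $G$ be an $\alpha$-weakly-Helly graph. For every $M\subseteq V(G)$, $G$ has a spanning tree $T$ such that for all $x\in V(G)$, $$e_T^M(x)-e_G^M(x)\le\lceil diam_G(C_G^{\alpha}(M))/2\rceil+3\alpha.$$
   Context: All graphs are finite, simple, undirected, unweighted and connected. A graph $G$ is $\alpha$-weakly-Helly if for every family of pairwise intersecting disks $\{D_G(v,r(v)) : v\in S\}$ (where $D_G(v,r)=\{u: d_G(u,v)\le r\}$) the disks $D_G(v,r(v)+\alpha)$, $v\in S$, have a common vertex. For a graph $X$ on vertex set containing $M$ and $v\in V(X)$: $e_X^M(v)=\max_{u\in M}d_X(v,u)$. Further $rad_G(M)=\min_{v\in V(G)}e_G^M(v)$, $C_G^{\ell}(M)=\{v: e_G^M(v)\le rad_G(M)+\ell\}$, and $diam_G(S)=\max_{u,v\in S}d_G(u,v)$. -}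

module Defs where

open import Data.Nat using (ℕ; zero; suc; _+_; _≤_; _⊔_; _⊓_; _≤ᵇ_)
open import Data.Bool using (Bool; true; false; _∧_; _∨_; if_then_else_; T)
open import Data.Fin using (Fin; _≟_)
open import Data.Fin.Subset using (Subset; _∈_)
open import Data.Vec using (lookup)
open import Data.List using (List; []; _∷_; map; foldr; length; _∷ʳ_; allFin)
open import Data.Bool.ListAction using (any)
open import Data.List.Relation.Unary.Unique.Propositional using (Unique)
open import Data.List.Relation.Unary.Linked using (Linked)
open import Data.Product using (∃; ∃-syntax; _×_)
open import Relation.Nullary using (¬_)
open import Relation.Nullary.Decidable using (⌊_⌋)
open import Relation.Binary.PropositionalEquality using (_≡_)

record Graph (n : ℕ) : Set where
  field
    adj   : Fin n → Fin n → Bool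
    sym   : ∀ u v → adj u v ≡ adj v u
    irrefl : ∀ u → adj u u ≡ false
open Graph public

reach : ∀ {n} → Graph n → ℕ → Fin n → Fin n → Bool
reach G zero    u v = ⌊ u ≟ v ⌋
reach G (suc k) u v = reach G k u v ∨ any (λ w → reach G k u w ∧ adj G w v) (allFin _)

Connected : ∀ {n} → Graph n → Set
Connected G = ∀ u v → ∃[ k ] T (reach G k u v)

-- least p b = the least k < b with p k = true (and b if there is none).
least : (ℕ → Bool) → ℕ → ℕ
least p zero    = zero
least p (suc b) = if p zero then zero else suc (least (λ k → p (suc k)) b)

-- graph distance d_G(u,v): the least k with a walk of length ≤ k
-- (a shortest walk in a connected graph on n vertices has length < n).
dist : ∀ {n} → Graph n → Fin n → Fin n → ℕ
dist {n} G u v = least (λ k → reach G k u v) n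

maxL : List ℕ → ℕ
maxL = foldr _⊔_ 0

minL : List ℕ → ℕ
minL []       = 0
minL (x ∷ xs) = foldr _⊓_ x xs

sel : ∀ {n} → Subset n → Fin n → ℕ → ℕ
sel S u x = if lookup S u then x else 0

ecc : ∀ {n} → Graph n → Subset n → Fin n → ℕ
ecc G M v = maxL (map (λ u → sel M u (dist G v u)) (allFin _))

rad : ∀ {n} → Graph n → Subset n → ℕ
rad G M = minL (map (ecc G M) (allFin _))

center : ∀ {n} → Graph n → ℕ → Subset n → Subset n
center G ℓ M = Data.Vec.tabulate (λ v → ecc G M v ≤ᵇ rad G M + ℓ)

diam : ∀ {n} → Graph n → Subset n → ℕ
diam G S = maxL (map (λ u → maxL (map (λ v → sel S u (sel S v (dist G u v))) (allFin _))) (allFin _))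

WeaklyHelly : ∀ {n} → ℕ → Graph n → Set
WeaklyHelly {n} α G =
  (S : Subset n) (r : Fin n → ℕ) →
  (∀ u v → u ∈ S → v ∈ S → ∃[ w ] (dist G u w ≤ r u × dist G v w ≤ r v)) →
  ∃[ w ] (∀ v → v ∈ S → dist G v w ≤ r v + α)

SubgraphOf : ∀ {n} → Graph n → Graph n → Set
SubgraphOf H G = ∀ u v → T (adj H u v) → T (adj G u v)

HasCycle : ∀ {n} → Graph n → Set
HasCycle {n} G = ∃[ x ] ∃[ ys ] (2 ≤ length ys × Unique (x ∷ ys)
                   × Linked (λ a b → T (adj G a b)) ((x ∷ ys) ∷ʳ x))

IsTree : ∀ {n} → Graph n → Set
IsTree G = Connected G × ¬ HasCycle G

IsSpanningTree : ∀ {n} → Graph n → Graph n → Set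
IsSpanningTree Tr G = SubgraphOf Tr G × IsTree Tr

module Submission where

-- Write r = rad_G(M), C = C_G^α(M), h = ⌈diam_G(C)/2⌉ and s(x) = e_G^M(x) ∸ r.
-- The tree is a shortest-path (BFS) tree T rooted at a well chosen vertex c,
-- so that d_T(x,u) ≤ d_G(c,x) + d_G(c,u) for all x, u.  The weak Helly
-- property is used through a single "two families of balls" lemma: balls of
-- radius a around a set A and of radius b around a set B that pairwise meet
-- have, after enlarging by α, a common vertex.  Applied to (C, h) and (M, r)
-- it yields the root c, with d(v,c) ≤ h + α on C and e(c) ≤ r + α; applied
-- to ({x}, s(x)) and (M, r) it yields for each x a vertex y ∈ C with
-- d(x,y) ≤ s(x) + α.  Hence for u ∈ M
--   d_T(x,u) ≤ d(c,y) + d(y,x) + d(c,u) ≤ (h+α) + (s(x)+α) + (r+α)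
--            = e_G^M(x) + h + 3α.

open import Defs hiding (sym)
open import Data.Nat using (ℕ; zero; suc; _+_; _*_; _≤_; _<_; _∸_; ⌈_/2⌉; _⊓_; _≤ᵇ_; z≤n; s≤s; s≤s⁻¹)
  renaming (_≟_ to _≟ℕ_)
open import Data.Nat.Properties hiding (_≟_)
open import Data.Nat.Tactic.RingSolver using (solve-∀)
open import Data.Bool using (Bool; true; false; _∨_; if_then_else_; T)
open import Data.Bool.Properties using (T-∨; T-∧; T-≡; T?; T-not-≡; ∨-comm)
open import Data.Fin using (Fin; _≟_; toℕ) renaming (zero to fzero; suc to fsuc)
open import Data.Fin.Subset using (Subset; _∈_; ⊤; ⁅_⁆)
open import Data.Fin.Subset.Properties using (∈⊤; x∈⁅x⁆; x∈⁅y⁆⇒x≡y)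
open import Data.Fin.Properties using (any?; pigeonhole)
open import Data.Vec using (lookup)
open import Data.Vec.Properties using ([]=⇒lookup; lookup⇒[]=; lookup∘tabulate)
open import Data.List using (List; []; _∷_; map; length; _∷ʳ_; allFin)
import Data.List as List
open import Data.List.Membership.Propositional renaming (_∈_ to _∈ₗ_) using ()
open import Data.List.Membership.Propositional.Properties using (∈-allFin; ∈-lookup; ∈-map⁺; ∈-map⁻)
import Data.List.Membership.DecPropositional as DecMembership
open import Data.List.Relation.Unary.Any as Any using (here; there)
open import Data.List.Relation.Unary.Any.Properties using (any⁺; any⁻)
open import Data.List.Relation.Unary.All as All using (All; []; _∷_)
open import Data.List.Relation.Unary.All.Properties using (¬Any⇒All¬)
open import Data.List.Relation.Unary.AllPairs using ([]; _∷_)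
open import Data.List.Relation.Unary.Unique.Propositional using (Unique)
open import Data.List.Relation.Unary.Linked using (Linked; _∷_)
open import Data.Product using (∃; ∃-syntax; _×_; _,_; proj₁; proj₂)
open import Data.Sum using (_⊎_; inj₁; inj₂; [_,_]′)
open import Data.Empty using (⊥-elim)
open import Data.Unit using (tt) renaming (⊤ to Unit)
open import Relation.Nullary using (¬_; Dec; yes; no)
open import Relation.Nullary.Decidable using (⌊_⌋; ¬?; _×-dec_; toWitness; fromWitness; fromWitnessFalse)
open import Relation.Binary.PropositionalEquality
open import Function.Bundles using (Equivalence)
open Equivalence using (to; from)

least-≤-bound : ∀ (p : ℕ → Bool) b → least p b ≤ b
least-≤-bound p zero = z≤n
least-≤-bound p (suc b) with p zero
... | true  = z≤n
... | false = s≤s (least-≤-bound (λ k → p (suc k)) b)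

least-minimal : ∀ (p : ℕ → Bool) b k → T (p k) → least p b ≤ k
least-minimal p zero k pk = z≤n
least-minimal p (suc b) k pk with p zero in p0
... | true = z≤n
least-minimal p (suc b) zero pk | false = ⊥-elim (subst T p0 pk)
least-minimal p (suc b) (suc k) pk | false = s≤s (least-minimal (λ j → p (suc j)) b k pk)

least-satisfies : ∀ (p : ℕ → Bool) b k → T (p k) → k < b → T (p (least p b))
least-satisfies p zero k pk ()
least-satisfies p (suc b) k pk k<b with p zero in p0
... | true = subst T (sym p0) tt
least-satisfies p (suc b) zero pk k<b | false = ⊥-elim (subst T p0 pk)
least-satisfies p (suc b) (suc k) pk (s≤s k<b) | false =
  least-satisfies (λ j → p (suc j)) b k pk k<b

maxL-upper : ∀ {x} xs → x ∈ₗ xs → x ≤ maxL xs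
maxL-upper (y ∷ xs) (here refl) = m≤m⊔n y (maxL xs)
maxL-upper (y ∷ xs) (there x∈) = ≤-trans (maxL-upper xs x∈) (m≤n⊔m y (maxL xs))

maxL-least : ∀ {A : Set} (f : A → ℕ) xs m → (∀ x → x ∈ₗ xs → f x ≤ m) → maxL (map f xs) ≤ m
maxL-least f [] m bound = z≤n
maxL-least f (x ∷ xs) m bound =
  ⊔-lub (bound x (here refl)) (maxL-least f xs m (λ y y∈ → bound y (there y∈)))

minL-lower : ∀ x xs {y} → y ∈ₗ (x ∷ xs) → minL (x ∷ xs) ≤ y
minL-lower x [] (here refl) = ≤-refl
minL-lower x (z ∷ zs) (here refl) = ≤-trans (m⊓n≤n z (minL (x ∷ zs))) (minL-lower x zs (here refl))
minL-lower x (z ∷ zs) (there (here refl)) = m⊓n≤m z (minL (x ∷ zs))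
minL-lower x (z ∷ zs) (there (there y∈)) = ≤-trans (m⊓n≤n z (minL (x ∷ zs))) (minL-lower x zs (there y∈))

minL-attained : ∀ x xs → minL (x ∷ xs) ∈ₗ (x ∷ xs)
minL-attained x [] = here refl
minL-attained x (z ∷ zs) with ⊓-sel z (minL (x ∷ zs))
... | inj₁ min≡z = there (here min≡z)
... | inj₂ min≡rest with minL-attained x zs
...   | here rest≡x = here (trans min≡rest rest≡x)
...   | there rest∈ = there (there (subst (_∈ₗ zs) (sym min≡rest) rest∈))

sel-∈ : ∀ {m} {S : Subset m} {u} x → u ∈ S → sel S u x ≡ x
sel-∈ {S = S} {u} x u∈S rewrite []=⇒lookup u∈S = refl

sel-≤ : ∀ {m} (S : Subset m) u x k → (u ∈ S → x ≤ k) → sel S u x ≤ k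
sel-≤ S u x k bound with lookup S u in eq
... | true  = bound (lookup⇒[]= u S eq)
... | false = z≤n

lookup-injective : ∀ {A : Set} (xs : List A) → Unique xs → ∀ i j → List.lookup xs i ≡ List.lookup xs j → i ≡ j
lookup-injective (x ∷ xs) _ fzero fzero _ = refl
lookup-injective (x ∷ xs) (x∉ ∷ _) fzero (fsuc j) eq = ⊥-elim (All.lookup x∉ (∈-lookup j) eq)
lookup-injective (x ∷ xs) (x∉ ∷ _) (fsuc i) fzero eq = ⊥-elim (All.lookup x∉ (∈-lookup i) (sym eq))
lookup-injective (x ∷ xs) (_ ∷ distinct) (fsuc i) (fsuc j) eq = cong fsuc (lookup-injective xs distinct i j eq)

unique-length : ∀ {m} (xs : List (Fin m)) → Unique xs → length xs ≤ m
unique-length {m} xs distinct with length xs ≤? m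
... | yes fits = fits
... | no overfull with pigeonhole (≰⇒> overfull) (List.lookup xs)
...   | i , j , i<j , same = ⊥-elim (<-irrefl (cong toℕ (lookup-injective xs distinct i j same)) i<j)

module Walks {n : ℕ} (G : Graph n) where

  open DecMembership (_≟_ {n}) using (_∈?_)

  Adj : Fin n → Fin n → Set
  Adj u v = T (adj G u v)

  adj-sym : ∀ {u v} → Adj u v → Adj v u
  adj-sym {u} {v} = subst T (Graph.sym G u v)

  -- `Reach k u v`: there is a walk of length at most k from u to v
  -- (a record, so that u and v can be inferred).
  record Reach (k : ℕ) (u v : Fin n) : Set where
    constructor reached
    field walk : T (reach G k u v)
  open Reach public

  reach-zero : ∀ {u v} → Reach 0 u v → u ≡ v
  reach-zero {u} {v} r = toWitness {a? = u ≟ v} (walk r)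

  reach-refl : ∀ {u} → Reach 0 u u
  reach-refl {u} = reached (fromWitness {a? = u ≟ u} refl)

  reach-last : ∀ {k u v} → Reach (suc k) u v → Reach k u v ⊎ ∃[ w ] (Reach k u w × Adj w v)
  reach-last {k} {u} {v} (reached r) with to (T-∨ {reach G k u v}) r
  ... | inj₁ shorter = inj₁ (reached shorter)
  ... | inj₂ viaLast with Any.satisfied (any⁻ _ (allFin n) viaLast)
  ...   | w , uw∧wv = inj₂ (w , reached (proj₁ (to T-∧ uw∧wv)) , proj₂ (to (T-∧ {reach G k u w}) uw∧wv))

  reach-weaken : ∀ {k u v} → Reach k u v → Reach (suc k) u v
  reach-weaken (reached r) = reached (from T-∨ (inj₁ r))

  reach-step : ∀ {k u w v} → Reach k u w → Adj w v → Reach (suc k) u v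
  reach-step {k} {u} {w} {v} (reached r) w~v =
    reached (from (T-∨ {reach G k u v}) (inj₂ (any⁺ _ (Any.map (λ { refl → from T-∧ (r , w~v) }) (∈-allFin w)))))

  reach-mono : ∀ {k m u v} → k ≤ m → Reach k u v → Reach m u v
  reach-mono {k} {m} {u} {v} k≤m r = subst (λ j → Reach j u v) (m∸n+n≡m k≤m) (pad (m ∸ k))
    where
    pad : ∀ j → Reach (j + k) u v
    pad zero    = r
    pad (suc j) = reach-weaken (pad j)

  reach-trans : ∀ {a u w} b {v} → Reach a u w → Reach b w v → Reach (a + b) u v
  reach-trans {a} {u} zero {v} r r′ with reach-zero r′
  ... | refl = subst (λ j → Reach j u v) (sym (+-identityʳ a)) r
  reach-trans {a} {u} (suc b) {v} r r′ rewrite +-suc a b with reach-last r′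
  ... | inj₁ shorter          = reach-weaken (reach-trans b r shorter)
  ... | inj₂ (x , r″ , x~v) = reach-step (reach-trans b r r″) x~v

  reach-sym : ∀ {k u v} → Reach k u v → Reach k v u
  reach-sym {zero} r with reach-zero r
  ... | refl = r
  reach-sym {suc k} r with reach-last r
  ... | inj₁ shorter          = reach-weaken (reach-sym shorter)
  ... | inj₂ (w , r′ , w~v) = reach-trans k (reach-step reach-refl (adj-sym w~v)) (reach-sym r′)

  reach-split : ∀ {a u v} b → Reach (a + b) u v → ∃[ w ] (Reach a u w × Reach b w v)
  reach-split {a} {u} {v} zero r = v , subst (λ j → Reach j u v) (+-identityʳ a) r , reach-refl
  reach-split {a} {u} {v} (suc b) r with reach-last (subst (λ j → Reach j u v) (+-suc a b) r)
  ... | inj₁ shorter = let w , uw , wv = reach-split b shorter in w , uw , reach-weaken wv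
  ... | inj₂ (x , ux , x~v) = let w , uw , wx = reach-split b ux in w , uw , reach-step wx x~v

  -- Paths: `Path u v xs` is a walk from u to v visiting the vertices xs after u.
  data Path : Fin n → Fin n → List (Fin n) → Set where
    []  : ∀ {v} → Path v v []
    _∷_ : ∀ {u w v xs} → Adj u w → Path w v xs → Path u v (w ∷ xs)

  path⇒reach : ∀ {u v xs} → Path u v xs → Reach (length xs) u v
  path⇒reach []         = reach-refl
  path⇒reach (u~w ∷ p) = reach-trans _ (reach-step reach-refl u~w) (path⇒reach p)

  path-snoc : ∀ {u w v xs} → Path u w xs → Adj w v → Path u v (xs ∷ʳ v)
  path-snoc []          w~v = w~v ∷ []
  path-snoc (u~x ∷ p) w~v = u~x ∷ path-snoc p w~v

  reach⇒path : ∀ k {u v} → Reach k u v → ∃[ xs ] Path u v xs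
  reach⇒path zero r with reach-zero r
  ... | refl = [] , []
  reach⇒path (suc k) r with reach-last r
  ... | inj₁ shorter = reach⇒path k shorter
  ... | inj₂ (w , uw , w~v) = let xs , p = reach⇒path k uw in xs ∷ʳ _ , path-snoc p w~v

  path-suffix : ∀ {x y v zs} → Path x v zs → y ∈ₗ (x ∷ zs) → Unique (x ∷ zs) →
                ∃[ ys ] (Path y v ys × Unique (y ∷ ys))
  path-suffix p (here refl) distinct = _ , p , distinct
  path-suffix (_ ∷ p) (there y∈) (_ ∷ distinct) = path-suffix p y∈ distinct

  -- Every path can be shortened to one without repeated vertices, by
  -- cutting out the part before the last visit of its start vertex.
  simple-path : ∀ {u v xs} → Path u v xs → ∃[ ys ] (Path u v ys × Unique (u ∷ ys))
  simple-path [] = [] , [] , [] ∷ []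
  simple-path {u} (_∷_ {w = w} u~w p) with simple-path p
  ... | ys , q , distinct with u ∈? (w ∷ ys)
  ...   | yes u∈ = path-suffix q u∈ distinct
  ...   | no u∉  = w ∷ ys , u~w ∷ q , ¬Any⇒All¬ (w ∷ ys) u∉ ∷ distinct

  reach-short : ∀ {k u v} → Reach k u v → ∃[ k′ ] (k′ < n × Reach k′ u v)
  reach-short {k} r with simple-path (proj₂ (reach⇒path k r))
  ... | ys , p , distinct = length ys , unique-length (_ ∷ ys) distinct , path⇒reach p

module Metric {n : ℕ} (G : Graph n) (connected : Connected G) where
  open Walks G public

  d : Fin n → Fin n → ℕ
  d = dist G

  dist-minimal : ∀ {k u v} → Reach k u v → d u v ≤ k
  dist-minimal {k} {u} {v} r = least-minimal (λ j → reach G j u v) n k (walk r)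

  dist-realised : ∀ {u v} → Reach (d u v) u v
  dist-realised {u} {v} with reach-short (reached {proj₁ (connected u v)} (proj₂ (connected u v)))
  ... | k , k<n , r = reached (least-satisfies (λ j → reach G j u v) n k (walk r) k<n)

  dist-bound : ∀ u v → d u v ≤ n
  dist-bound u v = least-≤-bound _ n

  dist-self : ∀ u → d u u ≡ 0
  dist-self u = n≤0⇒n≡0 (dist-minimal (reach-refl {u}))

  dist-zero : ∀ {u v} → d u v ≡ 0 → u ≡ v
  dist-zero {u} {v} duv≡0 = reach-zero (subst (λ j → Reach j u v) duv≡0 dist-realised)

  dist-sym : ∀ u v → d u v ≡ d v u
  dist-sym u v = ≤-antisym (dist-minimal (reach-sym dist-realised)) (dist-minimal (reach-sym dist-realised))

  dist-triangle : ∀ u v w → d u w ≤ d u v + d v w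
  dist-triangle u v w = dist-minimal (reach-trans (d v w) (dist-realised {u} {v}) dist-realised)

  balls-meet : ∀ {u v} a b → d u v ≤ a + b → ∃[ w ] (d u w ≤ a × d v w ≤ b)
  balls-meet {u} {v} a b duv≤ with reach-split b (reach-mono duv≤ (dist-realised {u} {v}))
  ... | w , uw , wv = w , dist-minimal uw , dist-minimal (reach-sym wv)

module Eccentricity {n : ℕ} (X : Graph n) (M : Subset n) where

  ecc-≥ : ∀ v u → u ∈ M → dist X v u ≤ ecc X M v
  ecc-≥ v u u∈M = subst (_≤ ecc X M v) (sel-∈ (dist X v u) u∈M)
    (maxL-upper (map (λ u → sel M u (dist X v u)) (allFin n)) (∈-map⁺ _ (∈-allFin u)))

  ecc-≤ : ∀ v m → (∀ u → u ∈ M → dist X v u ≤ m) → ecc X M v ≤ m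
  ecc-≤ v m bound = maxL-least _ (allFin n) m (λ u _ → sel-≤ M u (dist X v u) m (bound u))

  diam-≥ : ∀ (S : Subset n) u v → u ∈ S → v ∈ S → dist X u v ≤ diam X S
  diam-≥ S u v u∈S v∈S = ≤-trans row-bound (maxL-upper (map row (allFin n)) (∈-map⁺ row (∈-allFin u)))
    where
    row : Fin n → ℕ
    row u = maxL (map (λ v → sel S u (sel S v (dist X u v))) (allFin n))
    row-bound : dist X u v ≤ row u
    row-bound = subst (_≤ row u) (trans (sel-∈ _ u∈S) (sel-∈ _ v∈S))
      (maxL-upper (map (λ v → sel S u (sel S v (dist X u v))) (allFin n)) (∈-map⁺ _ (∈-allFin v)))

  centre-intro : ∀ ℓ v → ecc X M v ≤ rad X M + ℓ → v ∈ center X ℓ M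
  centre-intro ℓ v e≤ = lookup⇒[]= v (center X ℓ M)
    (trans (lookup∘tabulate _ v) (T-≡ .to (≤⇒≤ᵇ e≤)))

  centre-elim : ∀ ℓ v → v ∈ center X ℓ M → ecc X M v ≤ rad X M + ℓ
  centre-elim ℓ v v∈C = ≤ᵇ⇒≤ _ _ (T-≡ .from
    (trans (sym (lookup∘tabulate (λ v → ecc X M v ≤ᵇ rad X M + ℓ) v)) ([]=⇒lookup v∈C)))

rad-≤ : ∀ {n} (X : Graph (suc n)) M v → rad X M ≤ ecc X M v
rad-≤ X M v = minL-lower _ _ (∈-map⁺ (ecc X M) (∈-allFin v))

rad-attained : ∀ {n} (X : Graph (suc n)) M → ∃[ z ] (ecc X M z ≡ rad X M)
rad-attained X M with ∈-map⁻ (ecc X M) (minL-attained (ecc X M fzero) (map (ecc X M) (List.tabulate fsuc)))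
... | z , _ , rad≡ = z , sym rad≡

NonBacktracking : ∀ {A : Set} → List A → Set
NonBacktracking (a ∷ b ∷ c ∷ l) = a ≢ c × NonBacktracking (b ∷ c ∷ l)
NonBacktracking _ = Unit

nonBacktracking-close : ∀ {A : Set} (a b c : A) l x → Unique (a ∷ b ∷ c ∷ l) → All (_≢ x) (b ∷ c ∷ l) →
                        NonBacktracking ((a ∷ b ∷ c ∷ l) ∷ʳ x)
nonBacktracking-close a b c [] x ((_ ∷ a≢c ∷ _) ∷ _) (b≢x ∷ _) = a≢c , b≢x , tt
nonBacktracking-close a b c (e ∷ l) x ((_ ∷ a≢c ∷ _) ∷ distinct) (_ ∷ ≢x) =
  a≢c , nonBacktracking-close b c e l x distinct ≢x

cycle-nonBacktracking : ∀ {A : Set} {x y₁ y₂ : A} {zs} → Unique (x ∷ y₁ ∷ y₂ ∷ zs) →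
                        NonBacktracking ((x ∷ y₁ ∷ y₂ ∷ zs) ∷ʳ x)
cycle-nonBacktracking distinct@(x∉ ∷ _) =
  nonBacktracking-close _ _ _ _ _ distinct (All.map (λ x≢y y≡x → x≢y (sym y≡x)) x∉)

lastOf : ∀ {A : Set} → A → List A → A
lastOf b []      = b
lastOf b (x ∷ l) = lastOf x l

lastOf-∈ : ∀ {A : Set} (b : A) l → lastOf b l ∈ₗ (b ∷ l)
lastOf-∈ b []      = here refl
lastOf-∈ b (x ∷ l) = there (lastOf-∈ x l)

module ParentTree {n : ℕ} (G : Graph n) (c : Fin n) (h : Fin n → ℕ) (par : Fin n → Fin n)
    (par-adj : ∀ v → v ≢ c → T (adj G v (par v)))
    (par-height : ∀ v → v ≢ c → suc (h (par v)) ≡ h v)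
    (root-height : h c ≡ 0) where

  ParentEdge : Fin n → Fin n → Set
  ParentEdge u v = u ≢ c × v ≡ par u

  parentEdge? : ∀ u v → Dec (ParentEdge u v)
  parentEdge? u v = ¬? (u ≟ c) ×-dec (v ≟ par u)

  parent-lower : ∀ {u v} → ParentEdge u v → h v < h u
  parent-lower (u≢c , refl) = ≤-reflexive (par-height _ u≢c)

  no-self-parent : ∀ u → ¬ ParentEdge u u
  no-self-parent u up = <-irrefl refl (parent-lower up)

  treeAdj : Fin n → Fin n → Bool
  treeAdj u v = ⌊ parentEdge? u v ⌋ ∨ ⌊ parentEdge? v u ⌋

  treeAdj-irrefl : ∀ u → treeAdj u u ≡ false
  treeAdj-irrefl u rewrite T-not-≡ .to (fromWitnessFalse {a? = parentEdge? u u} (no-self-parent u)) = refl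

  Tr : Graph n
  Tr = record { adj = treeAdj
              ; sym = λ u v → ∨-comm ⌊ parentEdge? u v ⌋ ⌊ parentEdge? v u ⌋
              ; irrefl = treeAdj-irrefl }

  treeEdge : ∀ {u v} → T (adj Tr u v) → ParentEdge u v ⊎ ParentEdge v u
  treeEdge {u} {v} uv with to (T-∨ {⌊ parentEdge? u v ⌋}) uv
  ... | inj₁ u→v = inj₁ (toWitness u→v)
  ... | inj₂ v→u = inj₂ (toWitness v→u)

  parentEdge-tree : ∀ {u v} → ParentEdge u v → T (adj Tr u v)
  parentEdge-tree {u} {v} uv = from (T-∨ {⌊ parentEdge? u v ⌋}) (inj₁ (fromWitness uv))

  subgraph : SubgraphOf Tr G
  subgraph u v uv with treeEdge {u} {v} uv
  ... | inj₁ (u≢c , v≡par) = subst (λ w → T (adj G u w)) (sym v≡par) (par-adj u u≢c)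
  ... | inj₂ (v≢c , u≡par) = Walks.adj-sym G (subst (λ w → T (adj G v w)) (sym u≡par) (par-adj v v≢c))

  module TW = Walks Tr

  root-reach : ∀ k v → h v ≡ k → TW.Reach k c v
  root-reach zero v hv≡0 with v ≟ c
  ... | yes refl = TW.reach-refl
  ... | no v≢c   = ⊥-elim (0≢1+n (trans (sym hv≡0) (sym (par-height v v≢c))))
  root-reach (suc k) v hv≡ =
    TW.reach-step (root-reach k (par v) (suc-injective (trans (par-height v v≢c) hv≡)))
                  (TW.adj-sym {v} {par v} (parentEdge-tree {v} {par v} (v≢c , refl)))
    where
    v≢c : v ≢ c
    v≢c refl = 0≢1+n (trans (sym root-height) hv≡)

  tree-reach : ∀ x u → TW.Reach (h x + h u) x u
  tree-reach x u = TW.reach-trans (h u) (TW.reach-sym (root-reach _ x refl)) (root-reach _ u refl)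

  connected : Connected Tr
  connected x u = h x + h u , TW.walk (tree-reach x u)

  tree-dist : ∀ x u → dist Tr x u ≤ h x + h u
  tree-dist x u = least-minimal (λ j → reach Tr j x u) n _ (TW.walk (tree-reach x u))

  -- Call a step u → v of a tree walk rootward if v is the
  -- parent of u, and leafward if u is the parent of v.  In a walk that never
  -- backtracks, a leafward step can only be followed by leafward steps, and
  -- a rootward step can only be preceded by rootward steps.
  TreeWalk : List (Fin n) → Set
  TreeWalk = Linked (λ a b → T (adj Tr a b))

  same-parent : ∀ {b a x} → ParentEdge b a → ParentEdge b x → a ≡ x
  same-parent (_ , a≡) (_ , x≡) = trans a≡ (sym x≡)

  leafward-continues : ∀ {a b x} → ParentEdge b a → a ≢ x → T (adj Tr b x) → ParentEdge x b
  leafward-continues {a} {b} {x} ba a≢x bx with treeEdge {b} {x} bx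
  ... | inj₁ bx′ = ⊥-elim (a≢x (same-parent ba bx′))
  ... | inj₂ xb  = xb

  rootward-precedes : ∀ {a b x} → ParentEdge b x → a ≢ x → T (adj Tr a b) → ParentEdge a b
  rootward-precedes {a} {b} {x} bx a≢x ab with treeEdge {a} {b} ab
  ... | inj₁ ab′ = ab′
  ... | inj₂ ba  = ⊥-elim (a≢x (same-parent ba bx))

  ascent-persists : ∀ a b l e → TreeWalk (a ∷ b ∷ l ∷ʳ e) → NonBacktracking (a ∷ b ∷ l ∷ʳ e) →
                    ParentEdge b a → h a < h e
  ascent-persists a b [] e (_ ∷ be ∷ _) (a≢e , _) ba =
    <-trans (parent-lower ba) (parent-lower (leafward-continues ba a≢e be))
  ascent-persists a b (x ∷ l) e (_ ∷ walk@(bx ∷ _)) (a≢x , nb) ba =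
    <-trans (parent-lower ba) (ascent-persists b x l e walk nb (leafward-continues ba a≢x bx))

  descent-or-final-ascent : ∀ a b l e → TreeWalk (a ∷ b ∷ l ∷ʳ e) → NonBacktracking (a ∷ b ∷ l ∷ʳ e) →
                            (ParentEdge a b × h e < h a) ⊎ ParentEdge e (lastOf b l)
  descent-or-final-ascent a b [] e (ab ∷ be ∷ _) (a≢e , _) with treeEdge {b} {e} be
  ... | inj₂ eb = inj₂ eb
  ... | inj₁ be′ = let ab′ = rootward-precedes be′ a≢e ab in
                   inj₁ (ab′ , <-trans (parent-lower be′) (parent-lower ab′))
  descent-or-final-ascent a b (x ∷ l) e (ab ∷ walk) (a≢x , nb) with descent-or-final-ascent b x l e walk nb
  ... | inj₂ final = inj₂ final
  ... | inj₁ (bx , he<hb) = let ab′ = rootward-precedes bx a≢x ab in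
                            inj₁ (ab′ , <-trans he<hb (parent-lower ab′))

  -- A cycle x, y₁, y₂, …, x starting leafward would climb back to x, and one
  -- starting rootward either descends back to x or ends with a leafward step
  -- from its last vertex to x, making that vertex the parent of x, i.e. y₁.
  acyclic : ¬ HasCycle Tr
  acyclic (x , [] , () , _)
  acyclic (x , _ ∷ [] , s≤s () , _)
  acyclic (x , y₁ ∷ y₂ ∷ zs , _ , distinct@(_ ∷ y₁∉ ∷ _) , walk@(xy₁ ∷ _)) with treeEdge {x} {y₁} xy₁
  ... | inj₂ y₁x = <-irrefl refl (ascent-persists x y₁ (y₂ ∷ zs) x walk (cycle-nonBacktracking distinct) y₁x)
  ... | inj₁ xy₁′ with descent-or-final-ascent x y₁ (y₂ ∷ zs) x walk (cycle-nonBacktracking distinct)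
  ...   | inj₁ (_ , hx<hx) = <-irrefl refl hx<hx
  ...   | inj₂ final = All.lookup y₁∉ (lastOf-∈ y₂ zs) (same-parent xy₁′ final)

  spanningTree : IsSpanningTree Tr G
  spanningTree = subgraph , connected , acyclic

module BreadthFirst {n : ℕ} (G : Graph n) (connected : Connected G) (c : Fin n) where
  open Metric G connected

  Closer : Fin n → Fin n → Set
  Closer v w = Adj v w × suc (d c w) ≡ d c v

  closer? : ∀ v w → Dec (Closer v w)
  closer? v w = T? (adj G v w) ×-dec (suc (d c w) ≟ℕ d c v)

  -- Every v ≠ c has one: the last vertex before v on a shortest walk from c.
  closer-exists : ∀ v → v ≢ c → ∃ (Closer v)
  closer-exists v v≢c with d c v in dcv
  ... | zero = ⊥-elim (v≢c (sym (dist-zero dcv)))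
  ... | suc k with reach-last (subst (λ j → Reach j c v) dcv (dist-realised {c} {v}))
  ...   | inj₁ shorter = ⊥-elim (<-irrefl refl (≤-trans (≤-reflexive (sym dcv)) (dist-minimal shorter)))
  ...   | inj₂ (w , cw , w~v) = w , adj-sym {w} {v} w~v , cong suc (≤-antisym (dist-minimal cw) k≤dcw)
    where
    k≤dcw : k ≤ d c w
    k≤dcw = s≤s⁻¹ (subst (_≤ suc (d c w)) dcv (dist-minimal (reach-step (dist-realised {c} {w}) w~v)))

  par : Fin n → Fin n
  par v with any? (closer? v)
  ... | yes (w , _) = w
  ... | no _        = v

  par-closer : ∀ v → v ≢ c → Closer v (par v)
  par-closer v v≢c with any? (closer? v)
  ... | yes (_ , closer) = closer
  ... | no none          = ⊥-elim (none (closer-exists v v≢c))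

shortestPathTree : ∀ {n} (G : Graph n) → Connected G → (c : Fin n) →
                   ∃[ Tr ] (IsSpanningTree Tr G × ∀ x u → dist Tr x u ≤ dist G c x + dist G c u)
shortestPathTree G connected c = Tr , spanningTree , tree-dist
  where
  open BreadthFirst G connected c
  open ParentTree G c (dist G c) par (λ v v≢c → proj₁ (par-closer v v≢c))
                  (λ v v≢c → proj₂ (par-closer v v≢c)) (Metric.dist-self G connected c)

-- Radius a on the set A, and the never-binding radius n elsewhere.
capped : ∀ {n} → Subset n → ℕ → Fin n → ℕ
capped {n} A a v = if lookup A v then a else n

capped-∈ : ∀ {n} {A : Subset n} {a v} → v ∈ A → capped A a v ≡ a
capped-∈ v∈A rewrite []=⇒lookup v∈A = refl

capped-sum : ∀ {n} (A B : Subset n) a b {u v x} → x ≤ n → (u ∈ A → v ∈ B → x ≤ a + b) →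
             x ≤ capped A a u + capped B b v
capped-sum {n} A B a b {u} {v} x≤n bound with lookup A u in Au | lookup B v in Bv
... | true  | true  = bound (lookup⇒[]= u A Au) (lookup⇒[]= v B Bv)
... | true  | false = ≤-trans x≤n (m≤n+m n a)
... | false | _     = ≤-trans x≤n (m≤m+n n _)

sum-of-minima : ∀ {x} a₁ a₂ b₁ b₂ → x ≤ a₁ + b₁ → x ≤ a₁ + b₂ → x ≤ a₂ + b₁ → x ≤ a₂ + b₂ →
                x ≤ (a₁ ⊓ a₂) + (b₁ ⊓ b₂)
sum-of-minima {x} a₁ a₂ b₁ b₂ x≤₁₁ x≤₁₂ x≤₂₁ x≤₂₂ =
  subst (x ≤_) (sym (+-distribʳ-⊓ (b₁ ⊓ b₂) a₁ a₂))
    (⊓-glb (subst (x ≤_) (sym (+-distribˡ-⊓ a₁ b₁ b₂)) (⊓-glb x≤₁₁ x≤₁₂))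
           (subst (x ≤_) (sym (+-distribˡ-⊓ a₂ b₁ b₂)) (⊓-glb x≤₂₁ x≤₂₂)))

module Helly {n : ℕ} (G : Graph n) (connected : Connected G) (α : ℕ) (helly : WeaklyHelly α G) where
  open Metric G connected

  -- The weak
  -- Helly property is applied to all vertices, with radius a on A, b on B,
  -- their minimum on A ∩ B, and n (no constraint) elsewhere.
  two-family-helly : ∀ (A B : Subset n) (a b : ℕ) →
                     (∀ u v → u ∈ A → v ∈ A → d u v ≤ a + a) →
                     (∀ u v → u ∈ A → v ∈ B → d u v ≤ a + b) →
                     (∀ u v → u ∈ B → v ∈ B → d u v ≤ b + b) →
                     ∃[ w ] ((∀ v → v ∈ A → d v w ≤ a + α) × (∀ v → v ∈ B → d v w ≤ b + α))
  two-family-helly A B a b AA AB BB = w , on A a (λ v → m⊓n≤m (capped A a v) _) , on B b (λ v → m⊓n≤n _ (capped B b v))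
    where
    ρ : Fin n → ℕ
    ρ v = capped A a v ⊓ capped B b v

    BA : ∀ u v → u ∈ B → v ∈ A → d u v ≤ b + a
    BA u v u∈B v∈A = subst₂ _≤_ (dist-sym v u) (+-comm a b) (AB v u v∈A u∈B)

    pairwise : ∀ u v → d u v ≤ ρ u + ρ v
    pairwise u v = sum-of-minima (capped A a u) (capped B b u) (capped A a v) (capped B b v)
      (capped-sum A A a a (dist-bound u v) (AA u v)) (capped-sum A B a b (dist-bound u v) (AB u v))
      (capped-sum B A b a (dist-bound u v) (BA u v)) (capped-sum B B b b (dist-bound u v) (BB u v))

    common : ∃[ w ] (∀ v → v ∈ ⊤ → d v w ≤ ρ v + α)
    common = helly ⊤ ρ (λ u v _ _ → balls-meet (ρ u) (ρ v) (pairwise u v))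

    w : Fin n
    w = proj₁ common

    on : ∀ S s → (∀ v → ρ v ≤ capped S s v) → ∀ v → v ∈ S → d v w ≤ s + α
    on S s ρ≤ v v∈S = ≤-trans (proj₂ common v ∈⊤) (+-monoˡ-≤ α (≤-trans (ρ≤ v) (≤-reflexive (capped-∈ v∈S))))

stretch-arithmetic : ∀ h a s r → ((h + a) + (s + a)) + (r + a) ≡ (s + r) + (h + 3 * a)
stretch-arithmetic = solve-∀

module Construction (α : ℕ) {n : ℕ} (G : Graph (suc n)) (connected : Connected G)
                    (helly : WeaklyHelly α G) (M : Subset (suc n)) where
  open Metric G connected
  open Eccentricity G M
  open Helly G connected α helly

  r : ℕ
  r = rad G M

  e : Fin (suc n) → ℕ
  e = ecc G M

  C : Subset (suc n)
  C = center G α M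

  h : ℕ
  h = ⌈ diam G C /2⌉

  z : Fin (suc n)
  z = proj₁ (rad-attained G M)

  ecc-z : e z ≡ r
  ecc-z = proj₂ (rad-attained G M)

  z∈C : z ∈ C
  z∈C = centre-intro α z (≤-trans (≤-reflexive ecc-z) (m≤m+n r α))

  M-spread : ∀ u v → u ∈ M → v ∈ M → d u v ≤ r + r
  M-spread u v u∈M v∈M = ≤-trans (dist-triangle u z v) (+-mono-≤ (subst (_≤ r) (dist-sym z u) (to-z u u∈M)) (to-z v v∈M))
    where
    to-z : ∀ u → u ∈ M → d z u ≤ r
    to-z u u∈M = subst (d z u ≤_) ecc-z (ecc-≥ z u u∈M)

  centre-spread : ∀ u v → u ∈ C → v ∈ C → d u v ≤ h + h
  centre-spread u v u∈C v∈C = ≤-trans (diam-≥ C u v u∈C v∈C) diam≤2h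
    where
    diam≤2h : diam G C ≤ h + h
    diam≤2h = subst (_≤ h + h) (⌊n/2⌋+⌈n/2⌉≡n (diam G C)) (+-monoˡ-≤ h (⌊n/2⌋≤⌈n/2⌉ (diam G C)))

  centre-to-M : α ≤ h → ∀ u v → u ∈ C → v ∈ M → d u v ≤ h + r
  centre-to-M α≤h u v u∈C v∈M = begin
    d u v   ≤⟨ ecc-≥ u v v∈M ⟩
    e u     ≤⟨ centre-elim α u u∈C ⟩
    r + α   ≤⟨ +-monoʳ-≤ r α≤h ⟩
    r + h   ≡⟨ +-comm r h ⟩
    h + r   ∎
    where open ≤-Reasoning

  ecc-from-balls : ∀ w → (∀ v → v ∈ M → d v w ≤ r + α) → e w ≤ r + α
  ecc-from-balls w near-M = ecc-≤ w (r + α) (λ u u∈M → subst (_≤ r + α) (dist-sym u w) (near-M u u∈M))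

  -- If
  -- α > h, the vertex z will do; otherwise apply the Helly lemma to the
  -- balls of radius h around C and radius r around M.
  root-when-h<α : h < α → ∃[ c ] ((∀ v → v ∈ C → d v c ≤ h + α) × e c ≤ r + α)
  root-when-h<α h<α = z , (λ v v∈C → ≤-trans (centre-spread v z v∈C z∈C) (+-monoʳ-≤ h (<⇒≤ h<α)))
                        , ≤-trans (≤-reflexive ecc-z) (m≤m+n r α)

  root-when-α≤h : α ≤ h → ∃[ c ] ((∀ v → v ∈ C → d v c ≤ h + α) × e c ≤ r + α)
  root-when-α≤h α≤h =
    let c , near-C , near-M = two-family-helly C M h r centre-spread (centre-to-M α≤h) M-spread
    in c , near-C , ecc-from-balls c near-M

  central-root : ∃[ c ] ((∀ v → v ∈ C → d v c ≤ h + α) × e c ≤ r + α)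
  central-root = [ root-when-α≤h , root-when-h<α ]′ (≤-<-connex α h)

  -- Every x is within (e x ∸ r) + α of the centre: apply the Helly lemma to
  -- the ball of radius e x ∸ r around x and those of radius r around M.
  near-centre : ∀ x → ∃[ y ] (y ∈ C × d x y ≤ (e x ∸ r) + α)
  near-centre x =
    let y , near-x , near-M = two-family-helly ⁅ x ⁆ M (e x ∸ r) r x-x x-M M-spread
    in y , centre-intro α y (ecc-from-balls y near-M) , near-x x (x∈⁅x⁆ x)
    where
    x-x : ∀ u v → u ∈ ⁅ x ⁆ → v ∈ ⁅ x ⁆ → d u v ≤ (e x ∸ r) + (e x ∸ r)
    x-x u v u∈ v∈ rewrite x∈⁅y⁆⇒x≡y x u∈ | x∈⁅y⁆⇒x≡y x v∈ | dist-self x = z≤n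
    x-M : ∀ u v → u ∈ ⁅ x ⁆ → v ∈ M → d u v ≤ (e x ∸ r) + r
    x-M u v u∈ v∈M rewrite x∈⁅y⁆⇒x≡y x u∈ | m∸n+n≡m (rad-≤ G M x) = ecc-≥ x v v∈M

  stretch-bound : ∀ (Tr : Graph (suc n)) c → (∀ v → v ∈ C → d v c ≤ h + α) → e c ≤ r + α →
                  (∀ x u → dist Tr x u ≤ d c x + d c u) → ∀ x → ecc Tr M x ∸ e x ≤ h + 3 * α
  stretch-bound Tr c near-C ecc-c via-c x =
    m≤n+o⇒m∸n≤o (ecc Tr M x) (e x) (Eccentricity.ecc-≤ Tr M x (e x + (h + 3 * α)) tree-dist-to-M)
    where
    open ≤-Reasoning
    s : ℕ
    s = e x ∸ r

    root-to-x : d c x ≤ (h + α) + (s + α)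
    root-to-x = let y , y∈C , xy = near-centre x in begin
      d c x           ≤⟨ dist-triangle c y x ⟩
      d c y + d y x   ≡⟨ cong₂ _+_ (dist-sym c y) (dist-sym y x) ⟩
      d y c + d x y   ≤⟨ +-mono-≤ (near-C y y∈C) xy ⟩
      (h + α) + (s + α) ∎

    tree-dist-to-M : ∀ u → u ∈ M → dist Tr x u ≤ e x + (h + 3 * α)
    tree-dist-to-M u u∈M = begin
      dist Tr x u                       ≤⟨ via-c x u ⟩
      d c x + d c u                     ≤⟨ +-mono-≤ root-to-x (≤-trans (ecc-≥ c u u∈M) ecc-c) ⟩
      ((h + α) + (s + α)) + (r + α)     ≡⟨ stretch-arithmetic h α s r ⟩
      (s + r) + (h + 3 * α)             ≡⟨ cong (_+ (h + 3 * α)) (m∸n+n≡m (rad-≤ G M x)) ⟩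
      e x + (h + 3 * α)                 ∎

theorem7 : (α n : ℕ) (G : Graph n) → Connected G → WeaklyHelly α G →
           (M : Subset n) →
           ∃[ Tr ] (IsSpanningTree Tr G ×
             (∀ (x : Fin n) → ecc Tr M x ∸ ecc G M x ≤ ⌈ diam G (center G α M) /2⌉ + 3 * α))
theorem7 α zero G connected _ _ = G , ((λ _ _ uv → uv) , connected , λ { (() , _) }) , λ ()
theorem7 α (suc n) G connected helly M =
  let c , near-C , ecc-c    = central-root
      Tr , spanning , via-c = shortestPathTree G connected c
  in  Tr , spanning , stretch-bound Tr c near-C ecc-c via-c
  where open Construction α G connected helly M
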